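{- Let $(D,\sqcap)$ be a meet-semilattice with natural order $\sqsubseteq$, let $\tilde D\subseteq D$ be a complete subsemilattice of $(D,\sqcap)$, and let $\psi$ be a kernel operator on $(D,\sqsubseteq)$. Then $\psi(\tilde D)=\{\psi(d)\mid d\in\tilde D\}$ is a complete subsemilattice of $(\psi(D),\sqcap_\psi)$, where $\psi(D)=\{d\in D\mid\psi(d)=d\}$ is ordered by the restriction of $\sqsubseteq$ and $\sqcap_\psi$ denotes the meet in $\psi(D)$ (which satisfies $x\sqcap_\psi y=\psi(x\sqcap y)$).
   Context: The natural order of a meet-semilattice $(D,\sqcap)$ is $d_1\sqsubseteq d_2 \iff d_1\sqcap d_2=d_1$. A kernel operator (projection) on $(D,\sqsubseteq)$ is a map $\psi:D\to D$ that is monotone, contractive ($\psi(x)\sqsubseteq x$) and idempotent. A subset $S$ of a meet-semilattice $E$ is a complete subsemilattice if every nonempty subset of $S$ has an infimum in $E$ and this infimum belongs to $S$. -}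

module Defs where

open import Level using (Level; _⊔_; suc)
open import Data.Product using (Σ; ∃; _×_; _,_; proj₁)
open import Relation.Binary.Core using (Rel)
open import Relation.Unary using (Pred; _⊆_)
open import Algebra.Lattice.Bundles using (MeetSemilattice)

module _ {a r : Level} {A : Set a} (_≤_ : Rel A r) where

  IsLowerBound : {s : Level} → Pred A s → A → Set (a ⊔ r ⊔ s)
  IsLowerBound T m = ∀ {x} → T x → m ≤ x

  IsInfimum : {s : Level} → Pred A s → A → Set (a ⊔ r ⊔ s)
  IsInfimum T m = IsLowerBound T m × (∀ y → IsLowerBound T y → y ≤ m)

  IsCompleteSubsemilattice : (s : Level) → Pred A s → Set (a ⊔ r ⊔ suc s)
  IsCompleteSubsemilattice s S =
    (T : Pred A s) → T ⊆ S → (∃ λ x → T x) →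
    ∃ λ m → IsInfimum T m × S m

module _ {c ℓ : Level} (L : MeetSemilattice c ℓ) where
  open MeetSemilattice L renaming (Carrier to D; _∧_ to _⊓_)

  _⊑_ : Rel D ℓ
  d₁ ⊑ d₂ = (d₁ ⊓ d₂) ≈ d₁

  record IsKernelOperator (ψ : D → D) : Set (c ⊔ ℓ) where
    field
      monotone    : ∀ {x y} → x ⊑ y → ψ x ⊑ ψ y
      contractive : ∀ x → ψ x ⊑ x
      idempotent  : ∀ x → ψ (ψ x) ≈ ψ x

  Fix : (D → D) → Set (c ⊔ ℓ)
  Fix ψ = Σ D (λ d → ψ d ≈ d)

  -- order on ψ(D): restriction of ⊑ (the natural order of ⊓_ψ)
  _⊑ψ_ : {ψ : D → D} → Rel (Fix ψ) ℓ
  p ⊑ψ q = proj₁ p ⊑ proj₁ q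

  Image : {s : Level} (ψ : D → D) → Pred D s → Pred (Fix ψ) (c ⊔ ℓ ⊔ s)
  Image ψ D̃ p = ∃ λ d → D̃ d × (ψ d ≈ proj₁ p)

-- A kernel operator ψ sends the infimum m of a set P ⊆ D to the infimum of
-- ψ(P) in ψ(D): ψ m ⊑ ψ d by monotonicity, and a fixed point y below every
-- ψ d ⊑ d lies below m, so y = ψ y ⊑ ψ m. For nonempty T ⊆ ψ(D̃) one applies
-- this to the nonempty set P = {d ∈ D̃ | ψ d ∈ T}, whose infimum lies in D̃.
module Submission where

open import Defs
open import Level using (Level; _⊔_)
open import Relation.Unary using (Pred; _⊆_)
open import Algebra.Lattice.Bundles using (MeetSemilattice)
open import Data.Product using (∃; _×_; _,_; proj₁; proj₂)
import Relation.Binary.Construct.NaturalOrder.Left as LeftNaturalOrder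

module NaturalOrder {c ℓ : Level} (L : MeetSemilattice c ℓ) where
  open MeetSemilattice L renaming (Carrier to D; _∧_ to _⊓_)
  private module Left = LeftNaturalOrder _≈_ _⊓_

  -- The library's left natural order is x ≈ x ⊓ y, the symmetric form of ⊑.
  ⊑-trans : ∀ {x y z} → _⊑_ L x y → _⊑_ L y z → _⊑_ L x z
  ⊑-trans x⊑y y⊑z = sym (Left.trans isSemigroup (sym x⊑y) (sym y⊑z))

  ⊑-respʳ : ∀ {x y z} → y ≈ z → _⊑_ L x y → _⊑_ L x z
  ⊑-respʳ y≈z x⊑y = sym (Left.respʳ isMagma y≈z (sym x⊑y))

  ⊑-respˡ : ∀ {x y z} → y ≈ z → _⊑_ L y x → _⊑_ L z x
  ⊑-respˡ y≈z y⊑x = sym (Left.respˡ isMagma y≈z (sym y⊑x))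

module KernelOperator {c ℓ : Level} (L : MeetSemilattice c ℓ)
                      {ψ : MeetSemilattice.Carrier L → MeetSemilattice.Carrier L}
                      (K : IsKernelOperator L ψ) where
  open MeetSemilattice L renaming (Carrier to D)
  open IsKernelOperator K
  open NaturalOrder L

  fix : D → Fix L ψ
  fix d = ψ d , idempotent d

  fix-isInfimum : ∀ {s t} {P : Pred D s} {T : Pred (Fix L ψ) t} {m : D} →
    IsInfimum (_⊑_ L) P m →
    T ⊆ Image L ψ P →
    (∀ {d} → P d → ∃ λ q → T q × ψ d ≈ proj₁ q) →
    IsInfimum (_⊑ψ_ L {ψ}) T (fix m)
  fix-isInfimum {P = P} {T} {m} (m-lower , m-greatest) T⊆ψ[P] ψ[P]⊆T =
    fix-lower , fix-greatest
    where
    fix-lower : IsLowerBound (_⊑ψ_ L {ψ}) T (fix m)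
    fix-lower Tq with T⊆ψ[P] Tq
    ... | d , Pd , ψd≈q = ⊑-respʳ ψd≈q (monotone (m-lower Pd))

    fix-greatest : ∀ y → IsLowerBound (_⊑ψ_ L {ψ}) T y → _⊑ψ_ L {ψ} y (fix m)
    fix-greatest (y , ψy≈y) y-lower = ⊑-respˡ ψy≈y (monotone (m-greatest y y-lowerP))
      where
      y-lowerP : IsLowerBound (_⊑_ L) P y
      y-lowerP {d} Pd with ψ[P]⊆T Pd
      ... | q , Tq , ψd≈q = ⊑-trans (⊑-respʳ (sym ψd≈q) (y-lower Tq)) (contractive d)

corollary1 : {c ℓ : Level} (L : MeetSemilattice c ℓ) →
    let D = MeetSemilattice.Carrier L in
    (D̃ : Pred D (c ⊔ ℓ)) →
    IsCompleteSubsemilattice (_⊑_ L) (c ⊔ ℓ) D̃ →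
    (ψ : D → D) → IsKernelOperator L ψ →
    IsCompleteSubsemilattice (_⊑ψ_ L {ψ}) (c ⊔ ℓ) (Image L ψ D̃)
corollary1 {c} {ℓ} L D̃ D̃-complete ψ K T T⊆ψ[D̃] (_ , Tq) =
  fix-infimum (D̃-complete P proj₁ P-nonempty)
  where
  open MeetSemilattice L renaming (Carrier to D)
  open KernelOperator L K

  P : Pred D (c ⊔ ℓ)
  P d = D̃ d × ∃ λ q → T q × ψ d ≈ proj₁ q

  T⊆ψ[P] : T ⊆ Image L ψ P
  T⊆ψ[P] {q} Tq with T⊆ψ[D̃] Tq
  ... | d , D̃d , ψd≈q = d , (D̃d , q , Tq , ψd≈q) , ψd≈q

  P-nonempty : ∃ P
  P-nonempty with T⊆ψ[P] Tq
  ... | d , Pd , _ = d , Pd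

  fix-infimum : (∃ λ m → IsInfimum (_⊑_ L) P m × D̃ m) →
                ∃ λ p → IsInfimum (_⊑ψ_ L {ψ}) T p × Image L ψ D̃ p
  fix-infimum (m , m-isInfimum , D̃m) =
    fix m , fix-isInfimum m-isInfimum T⊆ψ[P] proj₂ , m , D̃m , refl
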